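{- Let $k\ge1$. Consider the binomial counter started by Initialize$(k)$ and then subjected to any number of Increment$(k)$ operations. At any time, $a_i=\binom{b_i+i-1}{i}$ for every $i\in\{1,\dots,k\}$.
   Context: The binomial counter maintains integers $a_1,\dots,a_k$ and $b_1,\dots,b_k$. Initialize$(k)$ sets $a_1=\dots=a_k=0$, $b_1=\dots=b_k=0$ and $b_{k+1}=\infty$. Increment$(k)$ does the following: let $i=\min\{j\in\{1,\dots,k\}: b_j<b_{j+1}\}$; set $a_i\leftarrow 1+\sum_{j=1}^i a_j$ (using the old values) and $b_i\leftarrow b_i+1$; then set $a_1,\dots,a_{i-1}\leftarrow0$ and $b_1,\dots,b_{i-1}\leftarrow0$. Binomial coefficients satisfy $\binom{m}{j}=0$ for $0\le m<j$. -}

module Defs where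

open import Data.Nat using (ℕ; zero; suc; _+_; _<ᵇ_)
open import Data.Bool using (if_then_else_)
open import Data.Nat.Combinatorics using (_C_)
open import Data.Product using (_×_; _,_; proj₁; proj₂)
open import Data.Vec using (Vec; []; _∷_; replicate; lookup)
open import Data.Fin using (Fin; toℕ)
open import Relation.Nullary using (yes; no)
open import Function using (_∘_)

-- State of the binomial counter with k positions: the j-th entry (0-based
-- index j, i.e. paper index j+1) is the pair (a_{j+1} , b_{j+1}).
State : ℕ → Set
State k = Vec (ℕ × ℕ) k

initialize : (k : ℕ) → State k
initialize k = replicate k (0 , 0)

-- Scan helper. incFrom s v: s is the sum of the (old) a_j over the already
-- scanned positions (all of which had b_j ≥ b_{j+1}).  At the current position
-- with pair (a , b): if it is the last position (b_{k+1} = ∞, so b < b_{k+1}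
-- always) or b < b_next, then this is the minimal index i; set
-- a_i := 1 + (s + a) = 1 + Σ_{j ≤ i} a_j and b_i := b + 1, leaving later
-- positions unchanged.
incFrom : {n : ℕ} → ℕ → State n → State n
incFrom s [] = []
incFrom s ((a , b) ∷ []) = (suc (s + a) , suc b) ∷ []
incFrom s ((a , b) ∷ (a' , b') ∷ rest) =
  if b <ᵇ b'
  then (suc (s + a) , suc b) ∷ (a' , b') ∷ rest
  else (0 , 0) ∷ incFrom (s + a) ((a' , b') ∷ rest)

increment : {k : ℕ} → State k → State k
increment = incFrom 0

iterate : {A : Set} → (A → A) → ℕ → A → A
iterate f zero x = x
iterate f (suc m) x = f (iterate f m x)

stateAfter : (k m : ℕ) → State k
stateAfter k m = iterate increment m (initialize k)

aOf : {k : ℕ} → State k → Fin k → ℕ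
aOf v j = proj₁ (lookup v j)

bOf : {k : ℕ} → State k → Fin k → ℕ
bOf v j = proj₂ (lookup v j)

{-# OPTIONS --safe #-}
-- The counter keeps two invariants: a_i = C(b_i + i - 1, i), and b_1 ≤ … ≤ b_k.
-- When Increment stops at i, every earlier position had b_j ≥ b_{j+1}, so by
-- monotonicity b_1 = … = b_i = b.  The scan then accumulates
-- 1 + Σ_{j ≤ i} C(b + j - 1, j) = C(b + i, i) one Pascal step at a time, which
-- is the new a_i for b_i = b + 1; reset positions hold (0 , 0) and C(j - 1, j) = 0.
module Submission where

open import Defs
open import Data.Nat using (ℕ; zero; suc; _+_; _≤_; _<ᵇ_; z≤n)
open import Data.Nat.Properties using (n<1+n; +-suc; +-identityʳ; ≤-antisym; ≮⇒≥; <ᵇ-reflects-<)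
open import Data.Nat.Combinatorics using (_C_; k>n⇒nCk≡0; nCk+nC[k+1]≡[n+1]C[k+1])
open import Data.Bool using (true; false)
open import Data.Unit using (⊤; tt)
open import Data.Product using (_×_; _,_; proj₁)
open import Data.Vec using ([]; _∷_)
open import Data.Fin using (Fin; toℕ; zero; suc)
open import Relation.Nullary.Reflects using (ofʸ; ofⁿ)
open import Relation.Binary.PropositionalEquality using (_≡_; refl; sym; trans; cong; cong₂; subst; module ≡-Reasoning)

-- The entry at offset j of a state satisfying BinomialFrom p is the pair with
-- paper index p + j + 1.
BinomialFrom : {n : ℕ} → ℕ → State n → Set
BinomialFrom p [] = ⊤
BinomialFrom p ((a , b) ∷ v) = a ≡ (b + p) C suc p × BinomialFrom (suc p) v

NondecreasingFrom : {n : ℕ} → ℕ → State n → Set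
NondecreasingFrom lo [] = ⊤
NondecreasingFrom lo ((a , b) ∷ v) = lo ≤ b × NondecreasingFrom b v

Invariant : {n : ℕ} → State n → Set
Invariant v = BinomialFrom 0 v × NondecreasingFrom 0 v

nC[1+n]≡0 : ∀ n → n C suc n ≡ 0
nC[1+n]≡0 n = k>n⇒nCk≡0 (n<1+n n)

pascal-accumulate : ∀ {s a} b p → suc s ≡ (b + p) C p → a ≡ (b + p) C suc p →
                    suc (s + a) ≡ (suc b + p) C suc p
pascal-accumulate b p s≡ a≡ = trans (cong₂ _+_ s≡ a≡) (nCk+nC[k+1]≡[n+1]C[k+1] (b + p) p)

initialize-binomialFrom : ∀ k p → BinomialFrom p (initialize k)
initialize-binomialFrom zero    p = tt
initialize-binomialFrom (suc k) p = sym (nC[1+n]≡0 p) , initialize-binomialFrom k (suc p)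

initialize-nondecreasing : ∀ k → NondecreasingFrom 0 (initialize k)
initialize-nondecreasing zero    = tt
initialize-nondecreasing (suc k) = z≤n , initialize-nondecreasing k

incFrom-nondecreasing : ∀ {n} s lo a b (v : State n) →
                        NondecreasingFrom lo ((a , b) ∷ v) → NondecreasingFrom 0 (incFrom s ((a , b) ∷ v))
incFrom-nondecreasing s lo a b [] _ = z≤n , tt
incFrom-nondecreasing s lo a b ((a' , b') ∷ v) (_ , b≤b' , mono)
  with b <ᵇ b' | <ᵇ-reflects-< b b'
... | true  | ofʸ b<b' = z≤n , b<b' , mono
... | false | _        = z≤n , incFrom-nondecreasing (s + a) b a' b' v (b≤b' , mono)

incFrom-binomialFrom : ∀ {n} p s lo a b (v : State n) →
                       NondecreasingFrom lo ((a , b) ∷ v) → BinomialFrom p ((a , b) ∷ v) →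
                       suc s ≡ (b + p) C p → BinomialFrom p (incFrom s ((a , b) ∷ v))
incFrom-binomialFrom p s lo a b [] _ (a≡ , _) s≡ = pascal-accumulate b p s≡ a≡ , tt
incFrom-binomialFrom p s lo a b ((a' , b') ∷ v) (_ , b≤b' , mono) (a≡ , binom) s≡
  with b <ᵇ b' | <ᵇ-reflects-< b b'
... | true  | _         = pascal-accumulate b p s≡ a≡ , binom
... | false | ofⁿ b≮b'  =
  sym (nC[1+n]≡0 p) , incFrom-binomialFrom (suc p) (s + a) b a' b' v (b≤b' , mono) binom s+a≡
  where
    open ≡-Reasoning
    s+a≡ : suc (s + a) ≡ (b' + suc p) C suc p
    s+a≡ = begin
      suc (s + a)          ≡⟨ pascal-accumulate b p s≡ a≡ ⟩
      (suc b + p) C suc p  ≡⟨ cong (_C suc p) (sym (+-suc b p)) ⟩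
      (b + suc p) C suc p  ≡⟨ cong (λ x → (x + suc p) C suc p) (≤-antisym b≤b' (≮⇒≥ b≮b')) ⟩
      (b' + suc p) C suc p ∎

increment-invariant : ∀ {n} (v : State n) → Invariant v → Invariant (increment v)
increment-invariant [] _ = tt , tt
increment-invariant ((a , b) ∷ v) (binom , mono) =
  incFrom-binomialFrom 0 0 0 a b v mono binom refl ,
  incFrom-nondecreasing 0 0 a b v mono

stateAfter-invariant : ∀ k m → Invariant (stateAfter k m)
stateAfter-invariant k zero    = initialize-binomialFrom k 0 , initialize-nondecreasing k
stateAfter-invariant k (suc m) = increment-invariant (stateAfter k m) (stateAfter-invariant k m)

lookup-binomialFrom : ∀ {n} p (v : State n) (j : Fin n) → BinomialFrom p v →
                      aOf v j ≡ (bOf v j + (p + toℕ j)) C suc (p + toℕ j)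
lookup-binomialFrom p ((a , b) ∷ v) zero (a≡ , _) =
  subst (λ x → a ≡ (b + x) C suc x) (sym (+-identityʳ p)) a≡
lookup-binomialFrom p ((a , b) ∷ v) (suc j) (_ , binom) =
  subst (λ x → aOf v j ≡ (bOf v j + x) C suc x) (sym (+-suc p (toℕ j)))
        (lookup-binomialFrom (suc p) v j binom)

lemma8p10 : (k : ℕ) → 1 ≤ k → (m : ℕ) → (j : Fin k) →
    aOf (stateAfter k m) j ≡ (bOf (stateAfter k m) j + toℕ j) C (suc (toℕ j))
lemma8p10 k _ m j = lookup-binomialFrom 0 (stateAfter k m) j (proj₁ (stateAfter-invariant k m))
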